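{- Let $G=(V,E)$ be a connected graph. If $|(\partial G)'|=3$, then $|\partial G|=3$.
   Context: Graphs are finite, simple, undirected; $d$ is the shortest-path distance. For a connected graph $G=(V,E)$, the CEJZ boundary is $(\partial G)'=\{v\in V:\ \exists u\in V \text{ with } d(w,u)\le d(v,u)\text{ for all } w\in N(v)\}$, and the Steinerberger boundary is $\partial G=\{v\in V:\ \exists u\in V \text{ with } \frac{1}{\deg(v)}\sum_{w\in N(v)} d(w,u)<d(v,u)\}$ (with $\partial G=V$ if $|V|=1$). -}

module Defs where

open import Data.Nat using (ℕ; zero; suc; _+_; _*_; _≤_; _<_)
open import Data.Fin using (Fin)
open import Data.Bool using (Bool; true; false; if_then_else_)
open import Data.List using (List; map; allFin)
open import Data.Nat.ListAction using (sum)
open import Data.Product using (Σ; ∃; _×_; _,_)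
open import Data.Sum using (_⊎_)
open import Relation.Binary.PropositionalEquality using (_≡_; _≢_)

record Graph (n : ℕ) : Set where
  field
    adj      : Fin n → Fin n → Bool
    adj-sym  : ∀ u v → adj u v ≡ adj v u
    adj-irr  : ∀ v → adj v v ≡ false

open Graph public

Adj : ∀ {n} → Graph n → Fin n → Fin n → Set
Adj G u v = adj G u v ≡ true

data Walk {n : ℕ} (G : Graph n) : Fin n → Fin n → ℕ → Set where
  nil  : ∀ {u} → Walk G u u 0
  cons : ∀ {u w v k} → Adj G u w → Walk G w v k → Walk G u v (suc k)

Connected : ∀ {n} → Graph n → Set
Connected G = ∀ u v → ∃ λ k → Walk G u v k

IsDist : ∀ {n} → Graph n → Fin n → Fin n → ℕ → Set
IsDist G u v k = Walk G u v k × (∀ m → Walk G u v m → k ≤ m)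

IsDistFun : ∀ {n} → Graph n → (Fin n → Fin n → ℕ) → Set
IsDistFun G d = ∀ u v → IsDist G u v (d u v)

Σv : ∀ {n} → (Fin n → ℕ) → ℕ
Σv {n} f = sum (map f (allFin n))

degree : ∀ {n} → Graph n → Fin n → ℕ
degree G v = Σv (λ w → if adj G v w then 1 else 0)

nbrDistSum : ∀ {n} → Graph n → (Fin n → Fin n → ℕ) → Fin n → Fin n → ℕ
nbrDistSum G d v u = Σv (λ w → if adj G v w then d w u else 0)

-- CEJZ boundary (∂G)'
InCEJZBoundary : ∀ {n} → Graph n → (Fin n → Fin n → ℕ) → Fin n → Set
InCEJZBoundary G d v = ∃ λ u → ∀ w → Adj G v w → d w u ≤ d v u

-- Steinerberger boundary ∂G:
-- (1/deg v) Σ_{w∈N(v)} d(w,u) < d(v,u), with denominators cleared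
-- (deg v > 0 whenever |V| ≥ 2 and G connected); ∂G = V if |V| = 1.
InSteinerbergerBoundary : ∀ {n} → Graph n → (Fin n → Fin n → ℕ) → Fin n → Set
InSteinerbergerBoundary {n} G d v =
  (n ≡ 1) ⊎ (∃ λ u → nbrDistSum G d v u < degree G v * d v u)

HasExactly3 : ∀ {n} → (Fin n → Set) → Set
HasExactly3 {n} P =
  Σ (Fin n) λ a → Σ (Fin n) λ b → Σ (Fin n) λ c →
    (a ≢ b) × (a ≢ c) × (b ≢ c) ×
    (∀ x → (P x → (x ≡ a ⊎ x ≡ b ⊎ x ≡ c)) × ((x ≡ a ⊎ x ≡ b ⊎ x ≡ c) → P x))

-- A vertex x of (∂G)' with witness u ≠ x has no neighbour farther from u and, on a geodesic,
-- one strictly closer, so its average neighbour distance is below d(x,u); the witness cannot be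
-- x itself once x has a neighbour. Conversely, extending a geodesic greedily until no neighbour
-- is farther ends in (∂G)'. If x had two distinct neighbours w₁, w₂ closer to u, such extensions
-- would give four distinct vertices of (∂G)': one nearer to w₁ than to w₂, one nearer to w₂,
-- one beyond x seen from u (where w₁, w₂ are both one step farther than x) and one beyond u seen
-- from x (where both are one step closer). Hence if |(∂G)'| = 3, at most one neighbour of x is
-- closer to u, and by exactly one, so the average drops below d(x,u) only if no neighbour is
-- farther, i.e. x ∈ (∂G)'.
module Submission where

open import Defs
open import Data.Nat using (ℕ; zero; suc; _+_; _*_; _≤_; _<_; _<?_; z≤n; s≤s)
open import Data.Nat.Properties hiding (_≟_)
open import Data.Fin using (Fin; zero; suc; _≟_)
open import Data.Fin.Properties using (any?)
open import Data.Bool using (Bool; true; false; if_then_else_)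
import Data.Bool.Properties as Bool
open import Data.List using (tabulate)
open import Data.List.Properties using (map-tabulate)
import Data.Nat.ListAction as ListAction
open import Data.List.Fresh using (List#; []; cons; length)
open import Data.List.Fresh.Relation.Unary.All using (All; []; _∷_)
open import Data.List.Fresh.Relation.Unary.Any using (here; there)
import Data.List.Fresh.Membership.Setoid as FreshMembership
open import Data.List.Fresh.Membership.Setoid.Properties using (injection)
open import Data.Product using (∃; _×_; _,_; proj₁; proj₂)
open import Data.Sum using (inj₁; inj₂)
open import Data.Empty using (⊥-elim)
open import Function using (id; _∘_)
open import Relation.Nullary using (¬_; Dec; does; yes; no; _×-dec_)
open import Relation.Binary.PropositionalEquality
open import Algebra.Properties.Semiring.Sum +-*-semiring
  using (sum; ∑-distrib-+; *-distribʳ-sum; sum-cong-≗; sum-replicate-zero)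

sum-tabulate : ∀ {n} (f : Fin n → ℕ) → ListAction.sum (tabulate f) ≡ sum f
sum-tabulate {zero} f = refl
sum-tabulate {suc n} f = cong (f zero +_) (sum-tabulate (f ∘ suc))

Σv≡sum : ∀ {n} (f : Fin n → ℕ) → Σv f ≡ sum f
Σv≡sum f = trans (cong ListAction.sum (map-tabulate id f)) (sum-tabulate f)

≤-sum : ∀ {n} (f : Fin n → ℕ) i → f i ≤ sum f
≤-sum f zero = m≤m+n (f zero) _
≤-sum f (suc i) = ≤-trans (≤-sum (f ∘ suc) i) (m≤n+m _ (f zero))

sum-mono-≤ : ∀ {n} {f g : Fin n → ℕ} → (∀ i → f i ≤ g i) → sum f ≤ sum g
sum-mono-≤ {zero} f≤g = z≤n
sum-mono-≤ {suc n} f≤g = +-mono-≤ (f≤g zero) (sum-mono-≤ (f≤g ∘ suc))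

sum-mono-< : ∀ {n} {f g : Fin n → ℕ} → (∀ i → f i ≤ g i) → ∀ j → f j < g j → sum f < sum g
sum-mono-< f≤g zero fj<gj = +-mono-<-≤ fj<gj (sum-mono-≤ (f≤g ∘ suc))
sum-mono-< f≤g (suc j) fj<gj = +-mono-≤-< (f≤g zero) (sum-mono-< (f≤g ∘ suc) j fj<gj)

indicator : ∀ {n} → Fin n → Fin n → ℕ
indicator j i = if does (i ≟ j) then 1 else 0

sum-indicator : ∀ {n} (j : Fin n) → sum (indicator j) ≡ 1
sum-indicator {suc n} zero = cong suc (sum-replicate-zero n)
sum-indicator {suc n} (suc j) = sum-indicator j

sum-mono-≤-exchange : ∀ {n} {f g : Fin n → ℕ} {j k : Fin n} → j ≢ k →
  (∀ i → i ≢ j → f i ≤ g i) → f j ≤ suc (g j) → f k < g k → sum f ≤ sum g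
sum-mono-≤-exchange {f = f} {g} {j} {k} j≢k f≤g fj≤1+gj fk<gk = +-cancelʳ-≤ 1 _ _ (begin
  sum f + 1                        ≡⟨ cong (sum f +_) (sym (sum-indicator k)) ⟩
  sum f + sum (indicator k)        ≡⟨ sym (∑-distrib-+ f (indicator k)) ⟩
  sum (λ i → f i + indicator k i)  ≤⟨ sum-mono-≤ pointwise ⟩
  sum (λ i → g i + indicator j i)  ≡⟨ ∑-distrib-+ g (indicator j) ⟩
  sum g + sum (indicator j)        ≡⟨ cong (sum g +_) (sum-indicator j) ⟩
  sum g + 1                        ∎)
  where
  open ≤-Reasoning
  pointwise : ∀ i → f i + indicator k i ≤ g i + indicator j i
  pointwise i with i ≟ j | i ≟ k
  ... | yes refl | yes refl = ⊥-elim (j≢k refl)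
  ... | yes refl | no _     = subst₂ _≤_ (sym (+-identityʳ (f i))) (+-comm 1 (g i)) fj≤1+gj
  ... | no _     | yes refl = subst₂ _≤_ (+-comm 1 (f i)) (sym (+-identityʳ (g i))) fk<gk
  ... | no i≢j   | no _     = +-monoˡ-≤ 0 (f≤g i i≢j)

sum-if-const : ∀ {n} (b : Fin n → Bool) k →
  sum (λ i → if b i then 1 else 0) * k ≡ sum (λ i → if b i then k else 0)
sum-if-const {n} b k = trans (*-distribʳ-sum {n} k _) (sum-cong-≗ (if-* ∘ b))
  where
  if-* : ∀ x → (if x then 1 else 0) * k ≡ (if x then k else 0)
  if-* true = +-identityʳ k
  if-* false = refl

∃-≢ : ∀ {n} {a b : Fin n} → a ≢ b → ∀ x → ∃ λ y → x ≢ y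
∃-≢ {a = a} {b} a≢b x with x ≟ a
... | yes refl = b , a≢b
... | no x≢a = a , x≢a

Fin1-≡ : ∀ {m} → m ≡ 1 → (x y : Fin m) → x ≡ y
Fin1-≡ refl zero zero = refl

AtMost : ∀ {A : Set} → ℕ → (A → Set) → Set
AtMost {A} k P = (xs : List# A _≢_) → All P xs → length xs ≤ k

module _ {A : Set} where
  open FreshMembership (setoid A)

  All⇒∈ : ∀ {P : A → Set} {xs : List# A _≢_} → All P xs → ∀ {x} → x ∈ xs → P x
  All⇒∈ (p ∷ _) (here refl) = p
  All⇒∈ (_ ∷ ps) (there x∈xs) = All⇒∈ ps x∈xs

HasExactly3⇒AtMost3 : ∀ {n} {P : Fin n → Set} → HasExactly3 P → AtMost 3 P
HasExactly3⇒AtMost3 {n} (a , b , c , a≢b , a≢c , b≢c , P⇔abc) xs Pxs =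
  injection (setoid (Fin n)) id {ys = abc} ∈abc
  where
  open FreshMembership (setoid (Fin n))
  abc : List# (Fin n) _≢_
  abc = cons a (cons b (cons c [] _) (b≢c , _)) (a≢b , a≢c , _)
  ∈abc : ∀ {x} → x ∈ xs → x ∈ abc
  ∈abc x∈xs with proj₁ (P⇔abc _) (All⇒∈ Pxs x∈xs)
  ... | inj₁ x≡a = here x≡a
  ... | inj₂ (inj₁ x≡b) = there (here x≡b)
  ... | inj₂ (inj₂ x≡c) = there (there (here x≡c))

module GraphProperties {n} (G : Graph n) where

  Adj-sym : ∀ {u v} → Adj G u v → Adj G v u
  Adj-sym {u} {v} u~v = trans (adj-sym G v u) u~v

  Adj⇒≢ : ∀ {u v} → Adj G u v → u ≢ v
  Adj⇒≢ {u} u~u refl with trans (sym u~u) (adj-irr G u)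
  ... | ()

  Adj? : ∀ u v → Dec (Adj G u v)
  Adj? u v = adj G u v Bool.≟ true

  walk-++ : ∀ {u v w k m} → Walk G u v k → Walk G v w m → Walk G u w (k + m)
  walk-++ nil q = q
  walk-++ (cons a p) q = cons a (walk-++ p q)

  walk-snoc : ∀ {u v w k} → Walk G u v k → Adj G v w → Walk G u w (suc k)
  walk-snoc nil v~w = cons v~w nil
  walk-snoc (cons a p) v~w = cons a (walk-snoc p v~w)

  walk-reverse : ∀ {u v k} → Walk G u v k → Walk G v u k
  walk-reverse nil = nil
  walk-reverse (cons a p) = walk-snoc (walk-reverse p) (Adj-sym a)

  walk-length-0 : ∀ {u v} → Walk G u v 0 → u ≡ v
  walk-length-0 nil = refl

  onN : Fin n → (Fin n → ℕ) → Fin n → ℕ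
  onN v f w = if adj G v w then f w else 0

  onN-Adj : ∀ {v w} (f : Fin n → ℕ) → Adj G v w → onN v f w ≡ f w
  onN-Adj f v~w rewrite v~w = refl

  onN-mono : ∀ {v} (f g : Fin n → ℕ) w → (Adj G v w → f w ≤ g w) → onN v f w ≤ onN v g w
  onN-mono {v} f g w fw≤gw with adj G v w
  ... | true = fw≤gw refl
  ... | false = z≤n

  degree*≡sum : ∀ v k → degree G v * k ≡ sum (onN v λ _ → k)
  degree*≡sum v k = trans (cong (_* k) (Σv≡sum (onN v λ _ → 1))) (sum-if-const (adj G v) k)

module Distance {n} {G : Graph n} {d : Fin n → Fin n → ℕ} (isDist : IsDistFun G d) where
  open GraphProperties G

  ∂′ : Fin n → Set
  ∂′ = InCEJZBoundary G d

  shortest : ∀ u v → Walk G u v (d u v)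
  shortest u v = proj₁ (isDist u v)

  d-minimal : ∀ {u v m} → Walk G u v m → d u v ≤ m
  d-minimal {u} {v} {m} = proj₂ (isDist u v) m

  d-sym : ∀ u v → d u v ≡ d v u
  d-sym u v =
    ≤-antisym (d-minimal (walk-reverse (shortest v u))) (d-minimal (walk-reverse (shortest u v)))

  d-triangle : ∀ u v w → d u w ≤ d u v + d v w
  d-triangle u v w = d-minimal (walk-++ (shortest u v) (shortest v w))

  d-Adj : ∀ {u v} w → Adj G u v → d u w ≤ suc (d v w)
  d-Adj w u~v = d-minimal (cons u~v (shortest _ w))

  d-refl : ∀ u → d u u ≡ 0
  d-refl u = n≤0⇒n≡0 (d-minimal (nil {u = u}))

  d≡0⇒≡ : ∀ {u v} → d u v ≡ 0 → u ≡ v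
  d≡0⇒≡ {u} {v} duv≡0 = walk-length-0 (subst (Walk G u v) duv≡0 (shortest u v))

  d-Adj-<⇒≡suc : ∀ {u v} w → Adj G u v → d u w < d v w → d v w ≡ suc (d u w)
  d-Adj-<⇒≡suc w u~v duw<dvw = ≤-antisym (d-Adj w (Adj-sym u~v)) duw<dvw

  closer-neighbour : ∀ {u v} → u ≢ v → ∃ λ w → Adj G u w × d w v < d u v
  closer-neighbour {u} {v} u≢v = first-step (shortest u v)
    where
    first-step : ∀ {k} → Walk G u v k → ∃ λ w → Adj G u w × d w v < k
    first-step nil = ⊥-elim (u≢v refl)
    first-step (cons u~w p) = _ , u~w , s≤s (d-minimal p)

  -- Greedily walk away from s; k bounds how much farther from s the walk can still get.
  ∃-∂′-beyond : ∀ s y → ∃ λ t → ∂′ t × d s t ≡ d s y + d y t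
  ∃-∂′-beyond s y₀ = go (sum (d s)) y₀ (λ z → ≤-trans (≤-sum (d s) z) (m≤n+m _ (d s y₀)))
    where
    go : ∀ k y → (∀ z → d s z ≤ d s y + k) → ∃ λ t → ∂′ t × d s t ≡ d s y + d y t
    go k y bound with any? (λ z → Adj? y z ×-dec (d s y <? d s z))
    ... | no no-farther =
      y , (s , y-∈∂′) , sym (trans (cong (d s y +_) (d-refl y)) (+-identityʳ _))
      where
      y-∈∂′ : ∀ w → Adj G y w → d w s ≤ d y s
      y-∈∂′ w y~w = subst₂ _≤_ (d-sym s w) (d-sym s y) (≮⇒≥ (λ y<w → no-farther (w , y~w , y<w)))
    go zero y bound | yes (z , _ , y<z) =
      ⊥-elim (<⇒≱ y<z (subst (d s z ≤_) (+-identityʳ _) (bound z)))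
    go (suc k) y bound | yes (z , y~z , y<z) with go k z (λ v → ≤-trans (bound v) shift)
      where
      shift : d s y + suc k ≤ d s z + k
      shift = ≤-trans (≤-reflexive (+-suc (d s y) k)) (+-monoˡ-≤ k y<z)
    ... | t , t-∈∂′ , z-on-geodesic = t , t-∈∂′ , ≤-antisym (d-triangle s y t) (begin
      d s y + d y t         ≤⟨ +-monoʳ-≤ (d s y) (d-Adj t y~z) ⟩
      d s y + suc (d z t)   ≡⟨ +-suc (d s y) (d z t) ⟩
      suc (d s y) + d z t   ≤⟨ +-monoˡ-≤ (d z t) y<z ⟩
      d s z + d z t         ≡⟨ sym z-on-geodesic ⟩
      d s t                 ∎)
      where open ≤-Reasoning

  d-order-flip⇒≢ : ∀ {p q s t} → d p s < d q s → d q t ≤ d p t → s ≢ t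
  d-order-flip⇒≢ dps<dqs dqt≤dpt refl = <⇒≱ dps<dqs dqt≤dpt

  ∃-∂′-separating : ∀ {w₁ w₂} → w₁ ≢ w₂ → ∃ λ t → ∂′ t × d w₁ t < d w₂ t
  ∃-∂′-separating {w₁} {w₂} w₁≢w₂ with ∃-∂′-beyond w₂ w₁
  ... | t , t-∈∂′ , w₁-on-geodesic =
    t , t-∈∂′ , subst (d w₁ t <_) (sym w₁-on-geodesic)
                  (m<n+m (d w₁ t) (n≢0⇒n>0 (w₁≢w₂ ∘ sym ∘ d≡0⇒≡)))

  Closer : Fin n → Fin n → Fin n → Set
  Closer x u w = Adj G x w × d w u < d x u

  ∃-∂′-nearer-x : ∀ x u → ∃ λ b → ∂′ b × (∀ {w} → Closer x u w → d x b < d w b)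
  ∃-∂′-nearer-x x u with ∃-∂′-beyond u x
  ... | b , b-∈∂′ , x-on-geodesic =
    b , b-∈∂′ , λ {w} (_ , w<x) → +-cancelˡ-< (d u x) _ _ (begin-strict
    d u x + d x b   ≡⟨ sym x-on-geodesic ⟩
    d u b           ≤⟨ d-triangle u w b ⟩
    d u w + d w b   <⟨ +-monoˡ-< (d w b) (subst₂ _<_ (d-sym w u) (d-sym x u) w<x) ⟩
    d u x + d w b   ∎)
    where open ≤-Reasoning

  ∃-∂′-nearer-neighbours : ∀ x u → ∃ λ b → ∂′ b × (∀ {w} → Closer x u w → d w b < d x b)
  ∃-∂′-nearer-neighbours x u with ∃-∂′-beyond x u
  ... | b , b-∈∂′ , u-on-geodesic =
    b , b-∈∂′ , λ {w} (_ , w<x) → begin-strict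
    d w b           ≤⟨ d-triangle w u b ⟩
    d w u + d u b   <⟨ +-monoˡ-< (d u b) w<x ⟩
    d x u + d u b   ≡⟨ sym u-on-geodesic ⟩
    d x b           ∎
    where open ≤-Reasoning

  closer-neighbour-unique : AtMost 3 ∂′ →
    ∀ {x u w₁ w₂} → Closer x u w₁ → Closer x u w₂ → w₁ ≡ w₂
  closer-neighbour-unique atMost3 {x} {u} {w₁} {w₂} c₁ c₂ with w₁ ≟ w₂
  ... | yes w₁≡w₂ = w₁≡w₂
  ... | no w₁≢w₂
    with ∃-∂′-separating w₁≢w₂ | ∃-∂′-separating (w₁≢w₂ ∘ sym)
       | ∃-∂′-nearer-x x u | ∃-∂′-nearer-neighbours x u
  ... | t₁ , t₁-∈∂′ , sep₁ | t₂ , t₂-∈∂′ , sep₂ | b , b-∈∂′ , far | b′ , b′-∈∂′ , near =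
    ⊥-elim (n≮n 3 (atMost3 four (t₁-∈∂′ ∷ t₂-∈∂′ ∷ b-∈∂′ ∷ b′-∈∂′ ∷ [])))
    where
    b-equidistant : d w₂ b ≡ d w₁ b
    b-equidistant =
      trans (d-Adj-<⇒≡suc b (proj₁ c₂) (far c₂)) (sym (d-Adj-<⇒≡suc b (proj₁ c₁) (far c₁)))
    b′-equidistant : d w₂ b′ ≡ d w₁ b′
    b′-equidistant = suc-injective (trans
      (sym (d-Adj-<⇒≡suc b′ (Adj-sym (proj₁ c₂)) (near c₂)))
      (d-Adj-<⇒≡suc b′ (Adj-sym (proj₁ c₁)) (near c₁)))
    four : List# (Fin n) _≢_
    four = cons t₁ (cons t₂ (cons b (cons b′ [] _)
             (d-order-flip⇒≢ (far c₁) (<⇒≤ (near c₁)) , _))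
             (d-order-flip⇒≢ sep₂ (≤-reflexive (sym b-equidistant)) ,
              d-order-flip⇒≢ sep₂ (≤-reflexive (sym b′-equidistant)) , _))
             (d-order-flip⇒≢ sep₁ (<⇒≤ sep₂) ,
              d-order-flip⇒≢ sep₁ (≤-reflexive b-equidistant) ,
              d-order-flip⇒≢ sep₁ (≤-reflexive b′-equidistant) , _)

  nbrDistSum≡sum : ∀ x u → nbrDistSum G d x u ≡ sum (onN x λ w → d w u)
  nbrDistSum≡sum x u = Σv≡sum (onN x λ w → d w u)

  Adj⇒d-refl< : ∀ {x w} → Adj G x w → d x x < d w x
  Adj⇒d-refl< {x} {w} x~w =
    subst (_< d w x) (sym (d-refl x)) (n≢0⇒n>0 (Adj⇒≢ x~w ∘ sym ∘ d≡0⇒≡))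

  ∂′⇒∂ : ∀ {x y} → x ≢ y → ∂′ x → InSteinerbergerBoundary G d x
  ∂′⇒∂ {x} x≢y (u , no-farther) with x ≟ u
  ... | yes refl with closer-neighbour x≢y
  ...   | w , x~w , _ = ⊥-elim (<⇒≱ (Adj⇒d-refl< x~w) (no-farther w x~w))
  ∂′⇒∂ {x} x≢y (u , no-farther) | no x≢u with closer-neighbour x≢u
  ... | w , x~w , w<x =
    inj₂ (u , subst₂ _<_ (sym (nbrDistSum≡sum x u)) (sym (degree*≡sum x (d x u))) sums)
    where
    sums : sum (onN x λ w → d w u) < sum (onN x λ _ → d x u)
    sums = sum-mono-< (λ i → onN-mono (λ w → d w u) (λ _ → d x u) i (no-farther i)) w
      (subst₂ _<_ (sym (onN-Adj (λ w → d w u) x~w)) (sym (onN-Adj (λ _ → d x u) x~w)) w<x)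

  degree*d≤nbrDistSum : ∀ {x u f} → (∀ {w₁ w₂} → Closer x u w₁ → Closer x u w₂ → w₁ ≡ w₂) →
    Adj G x f → d x u < d f u → degree G x * d x u ≤ nbrDistSum G d x u
  degree*d≤nbrDistSum {x} {u} {f} unique x~f x<f =
    subst₂ _≤_ (sym (degree*≡sum x (d x u))) (sym (nbrDistSum≡sum x u)) sums
    where
    not-closer : ∀ {w} → Adj G x w → ¬ Closer x u w → d x u ≤ d w u
    not-closer x~w ¬closer = ≮⇒≥ (λ w<x → ¬closer (x~w , w<x))
    sums : sum (onN x λ _ → d x u) ≤ sum (onN x λ w → d w u)
    sums with any? (λ w → Adj? x w ×-dec (d w u <? d x u))
    ... | no no-closer = sum-mono-≤ λ i →
      onN-mono (λ _ → d x u) (λ w → d w u) i (λ x~i → not-closer x~i (λ c → no-closer (i , c)))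
    ... | yes (w₁ , c₁@(x~w₁ , w₁<x)) = sum-mono-≤-exchange {j = w₁} {k = f}
      (λ { refl → <-asym w₁<x x<f })
      (λ i i≢w₁ → onN-mono (λ _ → d x u) (λ w → d w u) i
                    (λ x~i → not-closer x~i (λ c → i≢w₁ (unique c c₁))))
      (subst₂ _≤_ (sym (onN-Adj (λ _ → d x u) x~w₁)) (cong suc (sym (onN-Adj (λ w → d w u) x~w₁)))
        (d-Adj u x~w₁))
      (subst₂ _<_ (sym (onN-Adj (λ _ → d x u) x~f)) (sym (onN-Adj (λ w → d w u) x~f)) x<f)

  ∂⇒∂′ : AtMost 3 ∂′ → ∀ {x y} → x ≢ y → InSteinerbergerBoundary G d x → ∂′ x
  ∂⇒∂′ _ {x} {y} x≢y (inj₁ n≡1) = ⊥-elim (x≢y (Fin1-≡ n≡1 x y))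
  ∂⇒∂′ atMost3 _ (inj₂ (u , sum<)) = u , λ f x~f → ≮⇒≥ λ x<f →
    <⇒≱ sum< (degree*d≤nbrDistSum (closer-neighbour-unique atMost3) x~f x<f)

lemma4p1 : ∀ (n : ℕ) (G : Graph n) → Connected G →
    (d : Fin n → Fin n → ℕ) → IsDistFun G d →
    HasExactly3 (InCEJZBoundary G d) →
    HasExactly3 (InSteinerbergerBoundary G d)
lemma4p1 n G _ d isDist ∂′-exactly3@(a , b , c , a≢b , a≢c , b≢c , ∂′⇔abc) =
  a , b , c , a≢b , a≢c , b≢c , λ x →
    (λ x-∈∂ → proj₁ (∂′⇔abc x) (∂⇒∂′ (HasExactly3⇒AtMost3 ∂′-exactly3) (x≢other x) x-∈∂)) ,
    (λ x-∈abc → ∂′⇒∂ (x≢other x) (proj₂ (∂′⇔abc x) x-∈abc))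
  where
  open Distance isDist
  x≢other : ∀ x → x ≢ proj₁ (∃-≢ a≢b x)
  x≢other x = proj₂ (∃-≢ a≢b x)
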